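{- Let $d\ge 2$, let $p,q$ be integers with $q\ge 2$, $p\not\equiv 0\pmod q$ and $\gcd(p,q)=1$, and let $p^*$ be the multiplicative inverse of $p$ in $\mathbb{Z}/q\mathbb{Z}$. Let $n\ge 1$ and for each $1\le i\le n$ let $\mathcal{O}_i$ be the $\sigma_d$-orbit of a point $t_i\in\mathbb{T}$ with $|\mathcal{O}_i|=q$, where the orbits $\mathcal{O}_1,\dots,\mathcal{O}_n$ are pairwise distinct and $t_1<t_2<\dots<t_n$. Write $t_j=0.\overline{a_0^{(j)}a_1^{(j)}\dots a_{q-1}^{(j)}}$ in base $d$, with the digit indices viewed in $\mathbb{Z}/q\mathbb{Z}$. Then the following are equivalent: (i) each $t_i$ is the least element of $\mathcal{O}_i$, and $A=\bigcup_{i=1}^n\mathcal{O}_i$ is $\sigma_d$-rotational with rotation number equal to $p/q$ (as a rational number); (ii) the sequence of length $nq$ $$a_{0}^{(1)},\dots,a_{0}^{(n)},\ a_{p^*}^{(1)},\dots,a_{p^*}^{(n)},\ a_{2p^*}^{(1)},\dots,a_{2p^*}^{(n)},\ \dots,\ a_{(q-1)p^*}^{(1)},\dots,a_{(q-1)p^*}^{(n)}$$ (i.e. the terms $a^{(j)}_{kp^*}$ listed for $k=0,1,\dots,q-1$ in order, and for each $k$ for $j=1,\dots,n$ in order; subscripts reduced mod $q$) is nondecreasing, and moreover $a_{ -(p+1)p^*}^{(n)}<a_{ -pp^*}^{(1)}$.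
   Context: $\mathbb{T}=\mathbb{R}/\mathbb{Z}$, totally ordered by choosing representatives in $[0,1)$. $\sigma_d(t)=dt$ on $\mathbb{T}$; the orbit of $t$ is $\{\sigma_d^k(t):k\ge0\}$. A finite set $A=\{s_0<\dots<s_{m-1}\}$, indices in $\mathbb{Z}/m\mathbb{Z}$, is $\sigma_d$-rotational with rotation number $p'/m$ if $0\neq p'\in\mathbb{Z}/m\mathbb{Z}$ and $\sigma_d(s_i)=s_{i+p'}$ for all $i$; the rotation number need not be in lowest terms. A point of period $q$ under $\sigma_d$ has a purely periodic base-$d$ expansion $0.\overline{a_0a_1\dots a_{q-1}}$ with $a_i\in\{0,\dots,d-1\}$.
   Formalization: The points $t_i$, their orbits $\mathcal{O}_i$ and the set $A$ are taken in the rationals in [0,1) rather than in $\mathbb{T}=\mathbb{R}/\mathbb{Z}$. -}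

module Defs where

open import Data.Nat as ℕ using (ℕ; zero; suc)
open import Data.Integer as ℤ using (ℤ; +_)
open import Data.Integer.DivMod using (_%ℕ_)
open import Data.Rational as ℚ using (ℚ; floor; _/_)
open import Data.List using (List; length; map; concatMap; upTo)
open import Data.List.Membership.Propositional using (_∈_)
open import Data.List.Relation.Unary.Unique.Propositional using (Unique)
open import Data.Product using (Σ; ∃; _×_; _,_)
open import Relation.Binary.PropositionalEquality using (_≡_)
open import Relation.Nullary using (¬_)

toℚ : ℤ → ℚ
toℚ i = i / 1

-- Points of 𝕋 = ℝ/ℤ that can lie in a finite σ_d-orbit are rational, so we
-- model 𝕋 by rationals t with 0 ≤ t < 1 (the representative in [0,1)).
In𝕋 : ℚ → Set
In𝕋 t = (ℚ.0ℚ ℚ.≤ t) × (t ℚ.< ℚ.1ℚ)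

frac : ℚ → ℚ
frac x = x ℚ.- toℚ (floor x)

σ : ℕ → ℚ → ℚ
σ d t = frac (toℚ (+ d) ℚ.* t)

iter : ℕ → ℕ → ℚ → ℚ
iter d zero    t = t
iter d (suc k) t = σ d (iter d k t)

InOrbit : ℕ → ℚ → ℚ → Set
InOrbit d t s = ∃ λ k → iter d k t ≡ s

HasCard : (ℚ → Set) → ℕ → Set
HasCard P m = Σ (List ℚ) λ L →
  (length L ≡ m) × Unique L × (∀ s → (P s → s ∈ L) × (s ∈ L → P s))

SameSet : (ℚ → Set) → (ℚ → Set) → Set
SameSet P Q = ∀ s → (P s → Q s) × (Q s → P s)

-- natural number reduced mod m (m = 0 never used)
nmod : ℕ → ℕ → ℕ
nmod i zero    = i
nmod i (suc m) = i ℕ.% suc m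

-- A is σ_d-rotational with rotation number p'/m: A = {s_0 < ... < s_{m-1}},
-- 0 ≠ p' ∈ ℤ/mℤ (represented by 0 < p' < m), σ_d(s_i) = s_{i+p' mod m}.
RotationalWith : ℕ → (ℚ → Set) → ℕ → ℕ → Set
RotationalWith d A m p' =
  (0 ℕ.< p') × (p' ℕ.< m) ×
  Σ (ℕ → ℚ) λ s →
    (∀ i j → i ℕ.< j → j ℕ.< m → s i ℚ.< s j) ×
    (∀ x → (A x → ∃ λ i → (i ℕ.< m) × (s i ≡ x)) ×
           ((∃ λ i → (i ℕ.< m) × (s i ≡ x)) → A x)) ×
    (∀ i → i ℕ.< m → σ d (s i) ≡ s (nmod (i ℕ.+ p') m))

-- A is σ_d-rotational with rotation number equal to p/q (as an element of ℚ/ℤ,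
-- i.e. p'/m - p/q ∈ ℤ, equivalently p'·q ≡ p·m (mod m·q)).
RotationalWithNumber : ℕ → (ℚ → Set) → ℤ → ℕ → Set
RotationalWithNumber d A p q = ∃ λ m → ∃ λ p' →
  RotationalWith d A m p' ×
  (∃ λ (k : ℤ) → (+ p') ℤ.* (+ q) ≡ p ℤ.* (+ m) ℤ.+ k ℤ.* (+ m) ℤ.* (+ q))

-- integer reduced mod q, as a natural number in [0,q) (q = 0 never used)
zmod : ℤ → ℕ → ℕ
zmod i zero    = 0
zmod i (suc q) = i %ℕ suc q

digit : ℕ → ℚ → ℕ → ℤ
digit d t k = floor (toℚ (+ d) ℚ.* iter d k t)

a : ℕ → ℕ → ℚ → ℤ → ℤ
a d q t i = digit d t (zmod i q)

digitSeq : ℕ → ℕ → ℕ → (ℕ → ℚ) → ℤ → List ℤ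
digitSeq d q n t pstar =
  concatMap (λ k → map (λ j → a d q (t j) ((+ k) ℤ.* pstar)) (map suc (upTo n)))
            (upTo q)

{-# OPTIONS --safe #-}
module Submission where

-- Let p₀, p*₀ be the residues of p, p* mod q, and write i = k n + c (k < q, c < n). The i-th term
-- a^{(c+1)}_{k p*} of the sequence in (ii) is the leading digit of S i = σ^{k p*₀} (t_{c+1}), and
-- σ (S i) = S (i + n p₀ mod n q).
--
-- (ii) ⇒ (i): the S i are pairwise distinct and σ acts on their indices as the rotation by n p₀.
-- Their leading digits increase weakly along i and jump where this rotation wraps around, so σ maps
-- an inversion S j < S i (i < j) to an inversion with d times the gap, which is absurd after n q steps.
-- Hence S is increasing: A = {S i} is rotational with rotation number n p₀ / n q, and t_{c+1} = S c
-- is least in its orbit.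
--
-- (i) ⇒ (ii): if A = {s₀ < … < s_{rq-1}} with σ s_i = s_{i + r p₀}, minimality puts the rank of
-- t_{c+1} below r, and a^{(c+1)}_{k p*} is the leading digit of s_{rank + k r}.
-- These indices increase along the sequence, and σ reverses the order of the two points compared
-- in the strict inequality, so their leading digits differ.

open import Defs

open import Data.Fin using (Fin; zero; suc)
import Data.Fin.Properties as Fin
open import Data.Integer as ℤ using (ℤ; +_; 0ℤ; _⊖_)
import Data.Integer.DivMod as ℤD
open import Data.Integer.Divisibility using (_∣_)
import Data.Integer.Divisibility.Signed as Signed
open import Data.Integer.GCD using (gcd; gcd-zeroʳ)
import Data.Integer.Properties as ℤP
import Data.Integer.Tactic.RingSolver as ℤRing
open import Data.List using (List; []; _∷_; _++_; concat; map; length; lookup; applyUpTo; upTo)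
open import Data.List.Membership.Propositional using (_∈_)
open import Data.List.Membership.Propositional.Properties using (∈-lookup; ∈-applyUpTo⁺)
open import Data.List.Properties using (length-applyUpTo; map-applyUpTo; map-upTo)
import Data.List.Relation.Unary.All as All
import Data.List.Relation.Unary.All.Properties as AllP
open import Data.List.Relation.Unary.AllPairs using (AllPairs; _∷_)
open import Data.List.Relation.Unary.Any using (index)
open import Data.List.Relation.Unary.Any.Properties using (lookup-index)
open import Data.List.Relation.Unary.Linked using (Linked)
import Data.List.Relation.Unary.Linked.Properties as LinkedP
open import Data.List.Relation.Unary.Unique.Propositional using (Unique)
open import Data.Nat as ℕ using (ℕ; zero; suc; _+_; _*_; _∸_; _%_; _/_; z≤n; s≤s; NonZero)
import Data.Nat.DivMod as ℕD
import Data.Nat.Divisibility as ℕDiv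
import Data.Nat.Properties as ℕP
import Data.Nat.Tactic.RingSolver as ℕRing
open import Data.Product using (_×_; _,_; proj₁; proj₂; ∃)
open import Data.Rational as ℚ using (ℚ; mkℚ; floor)
import Data.Rational.Properties as ℚP
import Data.Rational.Solver as ℚSolver
open import Data.Sum using (_⊎_; inj₁; inj₂)
open import Function using (_∘_; id)
open import Function.Bundles using (_⇔_; mk⇔)
open import Level using (0ℓ)
open import Relation.Binary.Bundles using (Setoid)
open import Relation.Binary.Definitions using (Reflexive; Transitive; tri<; tri≈; tri>)
open import Relation.Binary.PropositionalEquality
  using (_≡_; _≢_; refl; sym; trans; cong; cong₂; subst; subst₂; module ≡-Reasoning)
import Relation.Binary.Reasoning.Setoid as SetoidReasoning
open import Relation.Nullary using (¬_; yes; no; contradiction)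

↥-toℚ : ∀ i → ℚ.↥ (toℚ i) ≡ i
↥-toℚ i = trans (sym (ℤP.*-identityʳ _)) (trans (cong (ℚ.↥ (toℚ i) ℤ.*_) (sym (gcd-zeroʳ i))) (ℚP.↥-/ i 1))

↧-toℚ : ∀ i → ℚ.↧ (toℚ i) ≡ + 1
↧-toℚ i = trans (sym (ℤP.*-identityʳ _)) (trans (cong (ℚ.↧ (toℚ i) ℤ.*_) (sym (gcd-zeroʳ i))) (ℚP.↧-/ i 1))

↥toℚ*↧toℚ : ∀ i j → ℚ.↥ (toℚ i) ℤ.* ℚ.↧ (toℚ j) ≡ i
↥toℚ*↧toℚ i j = trans (cong₂ ℤ._*_ (↥-toℚ i) (↧-toℚ j)) (ℤP.*-identityʳ i)

toℚ-mono-< : ∀ {i j} → i ℤ.< j → toℚ i ℚ.< toℚ j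
toℚ-mono-< {i} {j} = ℚ.*<* ∘ subst₂ ℤ._<_ (sym (↥toℚ*↧toℚ i j)) (sym (↥toℚ*↧toℚ j i))

toℚ-mono-≤ : ∀ {i j} → i ℤ.≤ j → toℚ i ℚ.≤ toℚ j
toℚ-mono-≤ {i} {j} = ℚ.*≤* ∘ subst₂ ℤ._≤_ (sym (↥toℚ*↧toℚ i j)) (sym (↥toℚ*↧toℚ j i))

floor-≤ : ∀ x → toℚ (floor x) ℚ.≤ x
floor-≤ x@(mkℚ n d-1 _) = ℚ.*≤* (subst₂ ℤ._≤_
  (sym (cong (ℤ._* ℚ.↧ x) (↥-toℚ (floor x))))
  (sym (trans (cong (n ℤ.*_) (↧-toℚ (floor x))) (ℤP.*-identityʳ n)))
  (ℤD.[n/d]*d≤n n (+ suc d-1)))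

≤-floor : ∀ z x → toℚ z ℚ.≤ x → z ℤ.≤ floor x
≤-floor z x@(mkℚ n d-1 _) (ℚ.*≤* z/1≤x) with z ℤ.≤? floor x
... | yes z≤⌊x⌋ = z≤⌊x⌋
... | no  z≰⌊x⌋ = contradiction (ℤP.≤-trans ⌊x⌋+1≤z*d z*d≤n) (ℤP.<⇒≱ (ℤD.n<s[n/ℕd]*d n (suc d-1)))
  where
  z*d≤n : z ℤ.* + suc d-1 ℤ.≤ n
  z*d≤n = subst₂ ℤ._≤_ (cong (ℤ._* + suc d-1) (↥-toℚ z))
                       (trans (cong (n ℤ.*_) (↧-toℚ z)) (ℤP.*-identityʳ n)) z/1≤x
  ⌊x⌋+1≤z*d : ℤ.suc (n ℤ./ℕ suc d-1) ℤ.* + suc d-1 ℤ.≤ z ℤ.* + suc d-1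
  ⌊x⌋+1≤z*d = ℤP.*-monoʳ-≤-nonNeg (+ suc d-1)
    (subst (λ f → ℤ.suc f ℤ.≤ z) (ℤD.div-pos-is-/ℕ n (suc d-1)) (ℤP.i<j⇒suc[i]≤j (ℤP.≰⇒> z≰⌊x⌋)))

floor-mono-≤ : ∀ {x y} → x ℚ.≤ y → floor x ℤ.≤ floor y
floor-mono-≤ {x} {y} x≤y = ≤-floor (floor x) y (ℚP.≤-trans (floor-≤ x) x≤y)

σ-mono-< : ∀ {d x y} → 0 ℕ.< d → digit d x 0 ≡ digit d y 0 → x ℚ.< y → σ d x ℚ.< σ d y
σ-mono-< {d} {x} {y} 0<d ⌊dx⌋≡⌊dy⌋ x<y rewrite ⌊dx⌋≡⌊dy⌋ =
  ℚP.+-monoˡ-< (ℚ.- toℚ (digit d y 0)) (ℚP.*-monoʳ-<-pos (toℚ (+ d)) {{d>0}} x<y)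
  where d>0 = ℚ.positive (toℚ-mono-< {+ 0} {+ d} (ℤ.+<+ 0<d))

σ-gap : ∀ {d x y} → digit d x 0 ≡ digit d y 0 → σ d y ℚ.- σ d x ≡ toℚ (+ d) ℚ.* (y ℚ.- x)
σ-gap {d} {x} {y} ⌊dx⌋≡⌊dy⌋ rewrite ⌊dx⌋≡⌊dy⌋ =
  solve 4 (λ D X Y F → (D :* Y :- F) :- (D :* X :- F) := D :* (Y :- X)) refl (toℚ (+ d)) x y (toℚ (digit d y 0))
  where open ℚSolver.+-*-Solver

σ-expands : ∀ {d x y} → 2 ℕ.≤ d → digit d x 0 ≡ digit d y 0 → x ℚ.< y → y ℚ.- x ℚ.< σ d y ℚ.- σ d x
σ-expands {d} {x} {y} 2≤d ⌊dx⌋≡⌊dy⌋ x<y = subst (y ℚ.- x ℚ.<_) (sym (σ-gap {d} {x} {y} ⌊dx⌋≡⌊dy⌋))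
  (subst (ℚ._< toℚ (+ d) ℚ.* (y ℚ.- x)) (ℚP.*-identityˡ (y ℚ.- x))
    (ℚP.*-monoˡ-<-pos (y ℚ.- x) {{y-x>0}} (toℚ-mono-< {+ 1} {+ d} (ℤ.+<+ 2≤d))))
  where y-x>0 = ℚ.positive (subst (ℚ._< y ℚ.- x) (ℚP.+-inverseʳ x) (ℚP.+-monoˡ-< (ℚ.- x) x<y))

digit-mono-≤ : ∀ d {x y} → x ℚ.≤ y → digit d x 0 ℤ.≤ digit d y 0
digit-mono-≤ d = floor-mono-≤ ∘ ℚP.*-monoˡ-≤-nonNeg (toℚ (+ d)) {{d≥0}}
  where d≥0 = ℚ.nonNegative (toℚ-mono-≤ {+ 0} {+ d} (ℤ.+≤+ z≤n))

σ-antitone⇒digit-< : ∀ {d x y} → 0 ℕ.< d → x ℚ.< y → σ d y ℚ.≤ σ d x → digit d x 0 ℤ.< digit d y 0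
σ-antitone⇒digit-< {d} 0<d x<y σy≤σx = ℤP.≤∧≢⇒< (digit-mono-≤ d (ℚP.<⇒≤ x<y))
  (λ ⌊dx⌋≡⌊dy⌋ → ℚP.<-irrefl refl (ℚP.<-≤-trans (σ-mono-< {d} 0<d ⌊dx⌋≡⌊dy⌋ x<y) σy≤σx))

module Congruence (N : ℕ) .{{_ : NonZero N}} where

  open Signed using (divides; ∣⇒∣ᵤ; ∣-refl; ∣m⇒∣-m; ∣m∣n⇒∣m+n; ∣m⇒∣m*n; ∣n⇒∣m*n)

  infix 4 _≈_
  record _≈_ (x y : ℤ) : Set where
    constructor mk≈
    field N∣x-y : + N Signed.∣ x ℤ.- y

  private
    via : ∀ {x y} → x ≡ y → + N Signed.∣ x → + N Signed.∣ y
    via = subst (+ N Signed.∣_)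

  ≈-refl : ∀ {x} → x ≈ x
  ≈-refl {x} = mk≈ (via (sym (ℤP.+-inverseʳ x)) (∣n⇒∣m*n 0ℤ ∣-refl))

  ≈-reflexive : ∀ {x y} → x ≡ y → x ≈ y
  ≈-reflexive refl = ≈-refl

  ≈-sym : ∀ {x y} → x ≈ y → y ≈ x
  ≈-sym {x} {y} (mk≈ h) = mk≈ (via (ring x y) (∣m⇒∣-m h))
    where
    ring : ∀ x y → ℤ.- (x ℤ.- y) ≡ y ℤ.- x
    ring = ℤRing.solve-∀

  ≈-trans : ∀ {x y z} → x ≈ y → y ≈ z → x ≈ z
  ≈-trans {x} {y} {z} (mk≈ h) (mk≈ k) = mk≈ (via (ring x y z) (∣m∣n⇒∣m+n h k))
    where
    ring : ∀ x y z → (x ℤ.- y) ℤ.+ (y ℤ.- z) ≡ x ℤ.- z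
    ring = ℤRing.solve-∀

  +-cong : ∀ {x y u v} → x ≈ y → u ≈ v → x ℤ.+ u ≈ y ℤ.+ v
  +-cong {x} {y} {u} {v} (mk≈ h) (mk≈ k) = mk≈ (via (ring x y u v) (∣m∣n⇒∣m+n h k))
    where
    ring : ∀ x y u v → (x ℤ.- y) ℤ.+ (u ℤ.- v) ≡ (x ℤ.+ u) ℤ.- (y ℤ.+ v)
    ring = ℤRing.solve-∀

  *-cong : ∀ {x y u v} → x ≈ y → u ≈ v → x ℤ.* u ≈ y ℤ.* v
  *-cong {x} {y} {u} {v} (mk≈ h) (mk≈ k) = mk≈ (via (ring x y u v) (∣m∣n⇒∣m+n (∣m⇒∣m*n u h) (∣n⇒∣m*n y k)))
    where
    ring : ∀ x y u v → (x ℤ.- y) ℤ.* u ℤ.+ y ℤ.* (u ℤ.- v) ≡ (x ℤ.* u) ℤ.- (y ℤ.* v)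
    ring = ℤRing.solve-∀

  -‿cong : ∀ {x y} → x ≈ y → ℤ.- x ≈ ℤ.- y
  -‿cong {x} {y} (mk≈ h) = mk≈ (via (ring x y) (∣m⇒∣-m h))
    where
    ring : ∀ x y → ℤ.- (x ℤ.- y) ≡ (ℤ.- x) ℤ.- (ℤ.- y)
    ring = ℤRing.solve-∀

  ≈-setoid : Setoid 0ℓ 0ℓ
  ≈-setoid = record { _≈_ = _≈_ ; isEquivalence = record { refl = ≈-refl ; sym = ≈-sym ; trans = ≈-trans } }

  ≈-by-quotient : ∀ {x y} k → x ℤ.- y ≡ k ℤ.* + N → x ≈ y
  ≈-by-quotient k eq = mk≈ (divides k eq)

  ∣⇒≈ : ∀ {x y} → + N ∣ x ℤ.- y → x ≈ y
  ∣⇒≈ = mk≈ ∘ Signed.∣ᵤ⇒∣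

  ≈0⇒∣ : ∀ {x} → x ≈ 0ℤ → + N ∣ x
  ≈0⇒∣ {x} (mk≈ N∣x-0) = ∣⇒∣ᵤ (subst (+ N Signed.∣_) (ℤP.+-identityʳ x) N∣x-0)

  N≈0 : + N ≈ 0ℤ
  N≈0 = mk≈ (via (sym (ℤP.+-identityʳ (+ N))) ∣-refl)

  x≈x%N : ∀ x → x ≈ + (x ℤD.%ℕ N)
  x≈x%N x = mk≈ (divides (x ℤD./ℕ N) (begin
    x ℤ.- + r                         ≡⟨ cong (ℤ._- + r) (ℤD.a≡a%ℕn+[a/ℕn]*n x N) ⟩
    + r ℤ.+ x ℤD./ℕ N ℤ.* + N ℤ.- + r ≡⟨ ring (+ r) (x ℤD./ℕ N ℤ.* + N) ⟩
    x ℤD./ℕ N ℤ.* + N                 ∎))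
    where
    open ≡-Reasoning
    r = x ℤD.%ℕ N
    ring : ∀ r k → r ℤ.+ k ℤ.- r ≡ k
    ring = ℤRing.solve-∀


  residue-unique : ∀ {a b} → a ℕ.< N → b ℕ.< N → + a ≈ + b → a ≡ b
  residue-unique {a} {b} a<N b<N (mk≈ N∣a-b) = ℤP.+-injective (ℤP.i-j≡0⇒i≡j (+ a) (+ b) (ℤP.∣i∣≡0⇒i≡0 ∣a-b∣≡0))
    where
    ∣a-b∣<N : ℤ.∣ + a ℤ.- + b ∣ ℕ.< N
    ∣a-b∣<N = subst (ℕ._< N) (cong ℤ.∣_∣ (sym (ℤP.m-n≡m⊖n a b)))
                (ℕP.≤-<-trans (ℤP.∣m⊝n∣≤m⊔n a b) (ℕP.⊔-lub a<N b<N))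
    ∣a-b∣≡0 : ℤ.∣ + a ℤ.- + b ∣ ≡ 0
    ∣a-b∣≡0 = trans (sym (ℕD.m<n⇒m%n≡m ∣a-b∣<N)) (ℕDiv.n∣m⇒m%n≡0 _ N (∣⇒∣ᵤ N∣a-b))

  %ℕ-cong : ∀ {x y} → x ≈ y → x ℤD.%ℕ N ≡ y ℤD.%ℕ N
  %ℕ-cong {x} {y} x≈y = residue-unique (ℤD.n%ℕd<d x N) (ℤD.n%ℕd<d y N)
    (≈-trans (≈-sym (x≈x%N x)) (≈-trans x≈y (x≈x%N y)))

  module ≈-Reasoning = SetoidReasoning ≈-setoid

  cancel-inverse : ∀ {a b} → + a ℤ.* + b ≈ + 1 → ∀ k → ((k * a) % N * b) % N ≡ k % N
  cancel-inverse {a} {b} ab≈1 k = %ℕ-cong (begin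
    + ((k * a) % N * b)     ≡⟨ ℤP.pos-* ((k * a) % N) b ⟩
    + ((k * a) % N) ℤ.* + b ≈⟨ *-cong (x≈x%N (+ (k * a))) (≈-refl {+ b}) ⟨
    + (k * a) ℤ.* + b       ≡⟨ cong (ℤ._* + b) (ℤP.pos-* k a) ⟩
    + k ℤ.* + a ℤ.* + b     ≡⟨ ℤP.*-assoc (+ k) (+ a) (+ b) ⟩
    + k ℤ.* (+ a ℤ.* + b)   ≈⟨ *-cong (≈-refl {+ k}) ab≈1 ⟩
    + k ℤ.* + 1             ≡⟨ ℤP.*-identityʳ (+ k) ⟩
    + k                     ∎)
    where open ≈-Reasoning

  ∸≈- : ∀ {m} → m ℕ.≤ N → + (N ∸ m) ≈ ℤ.- + m
  ∸≈- {m} m≤N = begin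
    + (N ∸ m)       ≡⟨ ℤP.⊖-≥ m≤N ⟨
    N ⊖ m           ≡⟨ ℤP.m-n≡m⊖n N m ⟨
    + N ℤ.+ ℤ.- + m ≈⟨ +-cong N≈0 (≈-refl {ℤ.- + m}) ⟩
    0ℤ ℤ.+ ℤ.- + m  ≡⟨ ℤP.+-identityˡ (ℤ.- + m) ⟩
    ℤ.- + m         ∎
    where open ≈-Reasoning

Unique⇒lookup-injective : ∀ {A : Set} {xs : List A} → Unique xs → ∀ i j → lookup xs i ≡ lookup xs j → i ≡ j
Unique⇒lookup-injective (_   ∷ _) zero    zero    _  = refl
Unique⇒lookup-injective (x∉ ∷ _) zero    (suc j) eq = contradiction eq (All.lookup x∉ (∈-lookup j))
Unique⇒lookup-injective (x∉ ∷ _) (suc i) zero    eq = contradiction (sym eq) (All.lookup x∉ (∈-lookup i))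
Unique⇒lookup-injective (_  ∷ u) (suc i) (suc j) eq = cong suc (Unique⇒lookup-injective u i j eq)

Unique-⊆⇒length≤ : ∀ {A : Set} {xs ys : List A} → Unique xs → (∀ {x} → x ∈ xs → x ∈ ys) → length xs ℕ.≤ length ys
Unique-⊆⇒length≤ {xs = xs} {ys} u xs⊆ys = Fin.injective⇒≤ {f = position} λ {i} {j} eq →
  Unique⇒lookup-injective u i j (begin
    lookup xs i            ≡⟨ lookup-index (xs⊆ys (∈-lookup i)) ⟩
    lookup ys (position i) ≡⟨ cong (lookup ys) eq ⟩
    lookup ys (position j) ≡⟨ lookup-index (xs⊆ys (∈-lookup j)) ⟨
    lookup xs j            ∎)
  where
  open ≡-Reasoning
  position : Fin (length xs) → Fin (length ys)
  position i = index (xs⊆ys (∈-lookup i))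

iter-+ : ∀ d a b t → iter d (a + b) t ≡ iter d a (iter d b t)
iter-+ d zero    b t = refl
iter-+ d (suc a) b t = cong (σ d) (iter-+ d a b t)

iter-*-period : ∀ d P {t} → iter d P t ≡ t → ∀ k → iter d (k * P) t ≡ t
iter-*-period d P     per zero    = refl
iter-*-period d P {t} per (suc k) = trans (iter-+ d P (k * P) t) (trans (cong (iter d P) (iter-*-period d P per k)) per)

iter-%-period : ∀ d P {t} .{{_ : NonZero P}} → iter d P t ≡ t → ∀ k → iter d k t ≡ iter d (k % P) t
iter-%-period d P {t} per k = begin
  iter d k t                            ≡⟨ cong (λ j → iter d j t) (ℕD.m≡m%n+[m/n]*n k P) ⟩
  iter d (k % P + k / P * P) t          ≡⟨ iter-+ d (k % P) (k / P * P) t ⟩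
  iter d (k % P) (iter d (k / P * P) t) ≡⟨ cong (iter d (k % P)) (iter-*-period d P per (k / P)) ⟩
  iter d (k % P) t                      ∎
  where open ≡-Reasoning

orbit-size≤period : ∀ d P {t m} .{{_ : NonZero P}} → HasCard (InOrbit d t) m → iter d P t ≡ t → m ℕ.≤ P
orbit-size≤period d P {t} (L , length≡m , unique , members) per =
  subst₂ ℕ._≤_ length≡m (length-applyUpTo (λ k → iter d k t) P) (Unique-⊆⇒length≤ unique L⊆orbit)
  where
  L⊆orbit : ∀ {x} → x ∈ L → x ∈ applyUpTo (λ k → iter d k t) P
  L⊆orbit {x} x∈L with k , refl ← proj₂ (members x) x∈L =
    subst (_∈ applyUpTo (λ k → iter d k t) P) (sym (iter-%-period d P per k)) (∈-applyUpTo⁺ _ (ℕD.m%n<n k P))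

-- Such a repetition gives t the period q - (b - a) < q, and an orbit is no larger than a period.
no-early-return : ∀ d q {t a b} → HasCard (InOrbit d t) q → iter d q t ≡ t →
                  a ℕ.< b → b ℕ.< q → iter d a t ≢ iter d b t
no-early-return d q {t} {a} {b} card per a<b b<q itᵃ≡itᵇ =
  ℕP.<⇒≱ P<q (orbit-size≤period d P {{ℕ.>-nonZero 0<P}} card per')
  where
  open ≡-Reasoning
  P = q ∸ b + a
  0<P : 0 ℕ.< P
  0<P = ℕP.<-≤-trans (ℕP.m<n⇒0<n∸m b<q) (ℕP.m≤m+n (q ∸ b) a)
  P<q : P ℕ.< q
  P<q = subst (P ℕ.<_) (ℕP.m∸n+n≡m (ℕP.<⇒≤ b<q)) (ℕP.+-monoʳ-< (q ∸ b) a<b)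
  per' : iter d P t ≡ t
  per' = begin
    iter d (q ∸ b + a) t        ≡⟨ iter-+ d (q ∸ b) a t ⟩
    iter d (q ∸ b) (iter d a t) ≡⟨ cong (iter d (q ∸ b)) itᵃ≡itᵇ ⟩
    iter d (q ∸ b) (iter d b t) ≡⟨ iter-+ d (q ∸ b) b t ⟨
    iter d (q ∸ b + b) t        ≡⟨ cong (λ k → iter d k t) (ℕP.m∸n+n≡m (ℕP.<⇒≤ b<q)) ⟩
    iter d q t                  ≡⟨ per ⟩
    t                           ∎

iter-injective : ∀ d q {t} e e' → HasCard (InOrbit d t) q → iter d q t ≡ t →
                 e ℕ.< q → e' ℕ.< q → iter d e t ≡ iter d e' t → e ≡ e'
iter-injective d q e e' card per e<q e'<q eq with ℕP.<-cmp e e'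
... | tri< e<e' _ _ = contradiction eq (no-early-return d q card per e<e' e'<q)
... | tri≈ _ e≡e' _ = e≡e'
... | tri> _ _ e>e' = contradiction (sym eq) (no-early-return d q card per e>e' e<q)

orbit-⊆ : ∀ d P e e' {x y} → iter d (suc P) x ≡ x → iter d e x ≡ iter d e' y →
          ∀ s → InOrbit d x s → InOrbit d y s
orbit-⊆ d P e e' {x} {y} per meet s (k , refl) = k + e * P + e' , (begin
  iter d (k + e * P + e') y        ≡⟨ iter-+ d (k + e * P) e' y ⟩
  iter d (k + e * P) (iter d e' y) ≡⟨ cong (iter d (k + e * P)) meet ⟨
  iter d (k + e * P) (iter d e x)  ≡⟨ iter-+ d (k + e * P) e x ⟨
  iter d (k + e * P + e) x         ≡⟨ cong (λ j → iter d j x) rearrange ⟩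
  iter d (k + e * suc P) x         ≡⟨ iter-+ d k (e * suc P) x ⟩
  iter d k (iter d (e * suc P) x)  ≡⟨ cong (iter d k) (iter-*-period d (suc P) per e) ⟩
  iter d k x                       ∎)
  where
  open ≡-Reasoning
  rearrange : k + e * P + e ≡ k + e * suc P
  rearrange = ℕRing.solve (k ∷ e ∷ P ∷ [])

sameOrbit : ∀ d P e e' {x y} → iter d (suc P) x ≡ x → iter d (suc P) y ≡ y →
            iter d e x ≡ iter d e' y → SameSet (InOrbit d x) (InOrbit d y)
sameOrbit d P e e' perx pery meet s = orbit-⊆ d P e e' perx meet s , orbit-⊆ d P e' e pery (sym meet) s

%-absorbˡ-+ : ∀ m n N .{{_ : NonZero N}} → (m % N + n) % N ≡ (m + n) % N
%-absorbˡ-+ m n N = begin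
  (m % N + n) % N         ≡⟨ ℕD.%-distribˡ-+ (m % N) n N ⟩
  (m % N % N + n % N) % N ≡⟨ cong (λ a → (a + n % N) % N) (ℕD.m%n%n≡m%n m N) ⟩
  (m % N + n % N) % N     ≡⟨ ℕD.%-distribˡ-+ m n N ⟨
  (m + n) % N             ∎
  where open ≡-Reasoning

module Rotation (N h : ℕ) .{{_ : NonZero N}} where

  rot : ℕ → ℕ
  rot i = (i + h) % N

  rot^ : ℕ → ℕ → ℕ
  rot^ zero    i = i
  rot^ (suc l) i = rot (rot^ l i)

  rot<N : ∀ i → rot i ℕ.< N
  rot<N i = ℕD.m%n<n (i + h) N

  rot^-closed : ∀ l {i} → i ℕ.< N → rot^ l i ≡ (i + l * h) % N
  rot^-closed zero    {i} i<N = sym (trans (cong (_% N) (ℕP.+-identityʳ i)) (ℕD.m<n⇒m%n≡m i<N))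
  rot^-closed (suc l) {i} i<N = begin
    (rot^ l i + h) % N        ≡⟨ cong (λ a → (a + h) % N) (rot^-closed l i<N) ⟩
    ((i + l * h) % N + h) % N ≡⟨ %-absorbˡ-+ (i + l * h) h N ⟩
    (i + l * h + h) % N       ≡⟨ cong (_% N) (ℕRing.solve (i ∷ l ∷ h ∷ [])) ⟩
    (i + suc l * h) % N       ∎
    where open ≡-Reasoning

  rot^N≡id : ∀ {i} → i ℕ.< N → rot^ N i ≡ i
  rot^N≡id {i} i<N = begin
    rot^ N i        ≡⟨ rot^-closed N i<N ⟩
    (i + N * h) % N ≡⟨ cong (λ a → (i + a) % N) (ℕP.*-comm N h) ⟩
    (i + h * N) % N ≡⟨ ℕD.[m+kn]%n≡m%n i h N ⟩
    i % N           ≡⟨ ℕD.m<n⇒m%n≡m i<N ⟩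
    i               ∎
    where open ≡-Reasoning

  iter-rotation : ∀ d (s : ℕ → ℚ) → (∀ {i} → i ℕ.< N → σ d (s i) ≡ s (rot i)) →
                  ∀ l {i} → i ℕ.< N → iter d l (s i) ≡ s (rot^ l i)
  iter-rotation d s σ-s zero    i<N = refl
  iter-rotation d s σ-s (suc l) i<N = trans (cong (σ d) (iter-rotation d s σ-s l i<N)) (σ-s (rot^<N l i<N))
    where
    rot^<N : ∀ l {i} → i ℕ.< N → rot^ l i ℕ.< N
    rot^<N zero    i<N = i<N
    rot^<N (suc l) _   = rot<N _

module SortedByDigits
  (d : ℕ) (2≤d : 2 ℕ.≤ d) (N h J : ℕ) .{{_ : NonZero N}} (cut : suc J + h ≡ N) (s : ℕ → ℚ)
  (σ-s : ∀ {i} → i ℕ.< N → σ d (s i) ≡ s (Rotation.rot N h i))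
  (digits-sorted : ∀ {i j} → i ℕ.≤ j → j ℕ.< N → digit d (s i) 0 ℤ.≤ digit d (s j) 0)
  (digit-jump : digit d (s J) 0 ℤ.< digit d (s (suc J)) 0)
  where

  open Rotation N h

  Inverted : ℕ → ℕ → Set
  Inverted i j = i ℕ.< j × j ℕ.< N × s j ℚ.< s i

  gap : ℕ → ℕ → ℚ
  gap i j = s i ℚ.- s j

  rot-below-cut : ∀ {i} → i ℕ.≤ J → rot i ≡ i + h
  rot-below-cut i≤J = ℕD.m<n⇒m%n≡m (subst (_ ℕ.<_) cut (ℕP.+-monoˡ-< h (s≤s i≤J)))

  rot-above-cut : ∀ {i} → J ℕ.< i → i ℕ.< N → rot i ≡ i ∸ suc J
  rot-above-cut {i} J<i i<N = begin
    (i + h) % N         ≡⟨ cong (_% N) i+h≡ ⟩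
    (i ∸ suc J + N) % N ≡⟨ ℕD.[m+n]%n≡m%n (i ∸ suc J) N ⟩
    (i ∸ suc J) % N     ≡⟨ ℕD.m<n⇒m%n≡m (ℕP.≤-<-trans (ℕP.m∸n≤m i (suc J)) i<N) ⟩
    i ∸ suc J           ∎
    where
    open ≡-Reasoning
    i+h≡ : i + h ≡ i ∸ suc J + N
    i+h≡ = begin
      i + h                   ≡⟨ cong (_+ h) (ℕP.m∸n+n≡m J<i) ⟨
      i ∸ suc J + suc J + h   ≡⟨ ℕP.+-assoc (i ∸ suc J) (suc J) h ⟩
      i ∸ suc J + (suc J + h) ≡⟨ cong (λ a → i ∸ suc J + a) cut ⟩
      i ∸ suc J + N           ∎

  flat-avoids-cut : ∀ {i j} → i ℕ.≤ j → j ℕ.< N → digit d (s i) 0 ≡ digit d (s j) 0 → j ℕ.≤ J ⊎ J ℕ.< i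
  flat-avoids-cut {i} {j} i≤j j<N flat with j ℕ.≤? J | J ℕ.<? i
  ... | yes j≤J | _       = inj₁ j≤J
  ... | no  _   | yes J<i = inj₂ J<i
  ... | no  j≰J | no  J≮i = contradiction flat (ℤP.<⇒≢ (begin-strict
    digit d (s i) 0       ≤⟨ digits-sorted (ℕP.≮⇒≥ J≮i) (ℕP.<-trans (ℕP.≰⇒> j≰J) j<N) ⟩
    digit d (s J) 0       <⟨ digit-jump ⟩
    digit d (s (suc J)) 0 ≤⟨ digits-sorted (ℕP.≰⇒> j≰J) j<N ⟩
    digit d (s j) 0       ∎))
    where open ℤP.≤-Reasoning

  rot-mono-on-flat : ∀ {i j} → i ℕ.< j → j ℕ.< N → digit d (s i) 0 ≡ digit d (s j) 0 → rot i ℕ.< rot j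
  rot-mono-on-flat {i} {j} i<j j<N flat with flat-avoids-cut (ℕP.<⇒≤ i<j) j<N flat
  ... | inj₁ j≤J = subst₂ ℕ._<_ (sym (rot-below-cut (ℕP.≤-trans (ℕP.<⇒≤ i<j) j≤J)))
                                (sym (rot-below-cut j≤J))
                                (ℕP.+-monoˡ-< h i<j)
  ... | inj₂ J<i = subst₂ ℕ._<_ (sym (rot-above-cut J<i (ℕP.<-trans i<j j<N)))
                                (sym (rot-above-cut (ℕP.<-trans J<i i<j) j<N))
                                (ℕP.∸-monoˡ-< i<j J<i)

  inversion-grows : ∀ {i j} → Inverted i j → Inverted (rot i) (rot j) × gap i j ℚ.< gap (rot i) (rot j)
  inversion-grows {i} {j} (i<j , j<N , sⱼ<sᵢ) =
    (rot-mono-on-flat i<j j<N flat , rot<N j , subst₂ ℚ._<_ (σ-s j<N) (σ-s i<N) (σ-mono-< {d} 0<d (sym flat) sⱼ<sᵢ)) ,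
    subst₂ (λ a b → gap i j ℚ.< a ℚ.- b) (σ-s i<N) (σ-s j<N) (σ-expands {d} 2≤d (sym flat) sⱼ<sᵢ)
    where
    i<N = ℕP.<-trans i<j j<N
    0<d = ℕP.<-trans (s≤s z≤n) 2≤d
    flat : digit d (s i) 0 ≡ digit d (s j) 0
    flat = ℤP.≤-antisym (digits-sorted (ℕP.<⇒≤ i<j) j<N) (digit-mono-≤ d (ℚP.<⇒≤ sⱼ<sᵢ))

  inversions-grow : ∀ l {i j} → Inverted i j →
                    Inverted (rot^ (suc l) i) (rot^ (suc l) j) × gap i j ℚ.< gap (rot^ (suc l) i) (rot^ (suc l) j)
  inversions-grow zero    inv = inversion-grows inv
  inversions-grow (suc l) inv with inv' , grown ← inversions-grow l inv =
    proj₁ (inversion-grows inv') , ℚP.<-trans grown (proj₂ (inversion-grows inv'))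

  no-inversion : ∀ {i j} → ¬ Inverted i j
  no-inversion {i} {j} inv@(i<j , j<N , _) =
    ℚP.<-irrefl (cong₂ gap (sym (rot^N i<N)) (sym (rot^N j<N))) (proj₂ (inversions-grow (J + h) inv))
    where
    rot^N : ∀ {k} → k ℕ.< N → rot^ (suc J + h) k ≡ k
    rot^N {k} k<N = subst (λ M → rot^ M k ≡ k) (sym cut) (rot^N≡id k<N)
    i<N = ℕP.<-trans i<j j<N

  increasing : (∀ {i j} → i ℕ.< N → j ℕ.< N → s i ≡ s j → i ≡ j) → ∀ {i j} → i ℕ.< j → j ℕ.< N → s i ℚ.< s j
  increasing s-injective {i} {j} i<j j<N with ℚP.<-cmp (s i) (s j)
  ... | tri< sᵢ<sⱼ _ _ = sᵢ<sⱼ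
  ... | tri≈ _ sᵢ≡sⱼ _ = contradiction (s-injective (ℕP.<-trans i<j j<N) j<N sᵢ≡sⱼ) (ℕP.<⇒≢ i<j)
  ... | tri> _ _ sⱼ<sᵢ = contradiction (i<j , j<N , sⱼ<sᵢ) no-inversion

applyUpTo-cong : ∀ {A : Set} {f g : ℕ → A} n → (∀ {i} → i ℕ.< n → f i ≡ g i) → applyUpTo f n ≡ applyUpTo g n
applyUpTo-cong zero    f≗g = refl
applyUpTo-cong (suc n) f≗g = cong₂ _∷_ (f≗g (s≤s z≤n)) (applyUpTo-cong n (f≗g ∘ s≤s))

applyUpTo-+ : ∀ {A : Set} (f : ℕ → A) m n → applyUpTo f (m + n) ≡ applyUpTo f m ++ applyUpTo (λ i → f (m + i)) n
applyUpTo-+ f zero    n = refl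
applyUpTo-+ f (suc m) n = cong (f 0 ∷_) (applyUpTo-+ (f ∘ suc) m n)

concat-applyUpTo : ∀ {A : Set} n .{{_ : NonZero n}} (f : ℕ → ℕ → A) q →
                   concat (applyUpTo (λ k → applyUpTo (f k) n) q) ≡ applyUpTo (λ i → f (i / n) (i % n)) (q * n)
concat-applyUpTo n f zero    = refl
concat-applyUpTo n f (suc q) = begin
  applyUpTo (f 0) n ++ concat (applyUpTo (λ k → applyUpTo (f (suc k)) n) q)
    ≡⟨ cong₂ _++_ (applyUpTo-cong n first-block) (concat-applyUpTo n (f ∘ suc) q) ⟩
  applyUpTo g n ++ applyUpTo (λ i → f (suc (i / n)) (i % n)) (q * n)
    ≡⟨ cong (applyUpTo g n ++_) (applyUpTo-cong (q * n) later-blocks) ⟩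
  applyUpTo g n ++ applyUpTo (λ i → g (n + i)) (q * n)
    ≡⟨ applyUpTo-+ g n (q * n) ⟨
  applyUpTo g (n + q * n)
    ∎
  where
  open ≡-Reasoning
  g : ℕ → _
  g i = f (i / n) (i % n)
  first-block : ∀ {i} → i ℕ.< n → f 0 i ≡ g i
  first-block i<n = sym (cong₂ f (ℕD.m<n⇒m/n≡0 i<n) (ℕD.m<n⇒m%n≡m i<n))
  later-blocks : ∀ {i} → i ℕ.< q * n → f (suc (i / n)) (i % n) ≡ g (n + i)
  later-blocks {i} _ = sym (cong₂ f
    (trans (ℕD.+-distrib-/-∣ˡ i (ℕDiv.∣-refl {n})) (cong (_+ i / n) (ℕD.n/n≡1 n)))
    (ℕD.%-remove-+ˡ i (ℕDiv.∣-refl {n})))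

AllPairs-applyUpTo⁻ : ∀ {A : Set} {R : A → A → Set} (f : ℕ → A) n → AllPairs R (applyUpTo f n) →
                      ∀ {i j} → i ℕ.< j → j ℕ.< n → R (f i) (f j)
AllPairs-applyUpTo⁻ f (suc n) (f₀~ ∷ _)     {zero}  {suc j} _         (s≤s j<n) = AllP.applyUpTo⁻ (f ∘ suc) n f₀~ j<n
AllPairs-applyUpTo⁻ f (suc n) (_ ∷ pairs) {suc i} {suc j} (s≤s i<j) (s≤s j<n) = AllPairs-applyUpTo⁻ (f ∘ suc) n pairs i<j j<n

Linked-applyUpTo⁻ : ∀ {A : Set} {R : A → A → Set} → Reflexive R → Transitive R → (f : ℕ → A) → ∀ n →
                    Linked R (applyUpTo f n) → ∀ {i j} → i ℕ.≤ j → j ℕ.< n → R (f i) (f j)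
Linked-applyUpTo⁻ refl' trans' f n linked i≤j j<n with ℕP.m≤n⇒m<n∨m≡n i≤j
... | inj₁ i<j  = AllPairs-applyUpTo⁻ f n (LinkedP.Linked⇒AllPairs trans' linked) i<j j<n
... | inj₂ refl = refl'

block-/ : ∀ n .{{_ : NonZero n}} k {c} → c ℕ.< n → (k * n + c) / n ≡ k
block-/ n k {c} c<n = begin
  (k * n + c) / n   ≡⟨ ℕD.+-distrib-/-∣ˡ c (ℕDiv.n∣m*n k) ⟩
  k * n / n + c / n ≡⟨ cong₂ _+_ (ℕD.m*n/n≡m k n) (ℕD.m<n⇒m/n≡0 c<n) ⟩
  k + 0             ≡⟨ ℕP.+-identityʳ k ⟩
  k                 ∎
  where open ≡-Reasoning

block-% : ∀ n .{{_ : NonZero n}} k {c} → c ℕ.< n → (k * n + c) % n ≡ c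
block-% n k c<n = trans (ℕD.%-remove-+ˡ _ (ℕDiv.n∣m*n k)) (ℕD.m<n⇒m%n≡m c<n)

block-split : ∀ n .{{_ : NonZero n}} i → i ≡ i / n * n + i % n
block-split n i = trans (ℕD.m≡m%n+[m/n]*n i n) (ℕP.+-comm (i % n) (i / n * n))

block-< : ∀ {q n k c} → k ℕ.< q → c ℕ.< n → k * n + c ℕ.< q * n
block-< {q} {n} {k} {c} k<q c<n = begin-strict
  k * n + c <⟨ ℕP.+-monoʳ-< (k * n) c<n ⟩
  k * n + n ≡⟨ ℕP.+-comm (k * n) n ⟩
  suc k * n ≤⟨ ℕP.*-monoˡ-≤ n k<q ⟩
  q * n     ∎
  where open ℕP.≤-Reasoning

block-shift : ∀ {q} n .{{_ : NonZero q}} .{{_ : NonZero (q * n)}} k h {c} → c ℕ.< n →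
              (k * n + c + h * n) % (q * n) ≡ (k + h) % q * n + c
block-shift {q} n k h {c} c<n = begin
  (k * n + c + h * n) % (q * n) ≡⟨ cong (_% (q * n)) (ℕRing.solve (k ∷ n ∷ c ∷ h ∷ [])) ⟩
  ((k + h) * n + c) % (q * n)   ≡⟨ ℕD.[m*n+o]%[p*n]≡[m*n]%[p*n]+o (k + h) q c<n ⟩
  (k + h) * n % (q * n) + c     ≡⟨ cong (_+ c) (ℕD.m%n*o≡m*o%[n*o] (k + h) q n) ⟨
  (k + h) % q * n + c           ∎
  where open ≡-Reasoning

module Setting
  (d : ℕ) (2≤d : 2 ℕ.≤ d) (p : ℤ) (q-1 : ℕ) (q∤p : ¬ (+ suc q-1 ∣ p))
  (pstar : ℤ) (inverse : + suc q-1 ∣ p ℤ.* pstar ℤ.- + 1) (n-1 : ℕ) (t : ℕ → ℚ)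
  where

  q n : ℕ
  q = suc q-1
  n = suc n-1

  open Congruence q

  p₀ pstar₀ : ℕ
  p₀ = p ℤD.%ℕ q
  pstar₀ = pstar ℤD.%ℕ q

  p₀<q : p₀ ℕ.< q
  p₀<q = ℤD.n%ℕd<d p q

  0<p₀ : 0 ℕ.< p₀
  0<p₀ = ℕP.n≢0⇒n>0 λ p₀≡0 → q∤p (≈0⇒∣ (≈-trans (x≈x%N p) (≈-reflexive (cong +_ p₀≡0))))

  q∸p₀≡1+q∸[1+p₀] : q ∸ p₀ ≡ suc (q ∸ suc p₀)
  q∸p₀≡1+q∸[1+p₀] = ℕP.+-∸-assoc 1 {q-1} {p₀} (ℕP.≤-pred p₀<q)

  ppstar≈1 : p ℤ.* pstar ≈ + 1
  ppstar≈1 = ∣⇒≈ inverse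

  p₀pstar₀≈1 : + p₀ ℤ.* + pstar₀ ≈ + 1
  p₀pstar₀≈1 = ≈-trans (*-cong (≈-sym (x≈x%N p)) (≈-sym (x≈x%N pstar))) ppstar≈1

  digitIndex : ℕ → ℕ
  digitIndex k = (k * pstar₀) % q

  zmod≡digitIndex : ∀ k → zmod (+ k ℤ.* pstar) q ≡ digitIndex k
  zmod≡digitIndex k = %ℕ-cong (≈-trans (*-cong (≈-refl {+ k}) (x≈x%N pstar)) (≈-reflexive (sym (ℤP.pos-* k pstar₀))))

  digitIndex-cancel-p₀ : ∀ k → digitIndex ((k * p₀) % q) ≡ k % q
  digitIndex-cancel-p₀ = cancel-inverse p₀pstar₀≈1

  p₀-cancel-digitIndex : ∀ {k} → k ℕ.< q → (digitIndex k * p₀) % q ≡ k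
  p₀-cancel-digitIndex {k} k<q =
    trans (cancel-inverse (≈-trans (≈-reflexive (ℤP.*-comm (+ pstar₀) (+ p₀))) p₀pstar₀≈1) k) (ℕD.m<n⇒m%n≡m k<q)

  digitIndex-suc : ∀ k → suc (digitIndex k) % q ≡ digitIndex ((k + p₀) % q)
  digitIndex-suc k = %ℕ-cong (begin
    + suc (digitIndex k)                   ≡⟨ ℤP.pos-+ 1 (digitIndex k) ⟩
    + 1 ℤ.+ + digitIndex k                 ≈⟨ +-cong p₀pstar₀≈1 (x≈x%N (+ (k * pstar₀))) ⟨
    + p₀ ℤ.* + pstar₀ ℤ.+ + (k * pstar₀)   ≡⟨ cong (λ a → + p₀ ℤ.* + pstar₀ ℤ.+ a) (ℤP.pos-* k pstar₀) ⟩
    + p₀ ℤ.* + pstar₀ ℤ.+ + k ℤ.* + pstar₀ ≡⟨ ℤP.*-distribʳ-+ (+ pstar₀) (+ p₀) (+ k) ⟨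
    (+ p₀ ℤ.+ + k) ℤ.* + pstar₀            ≡⟨ cong (ℤ._* + pstar₀) (trans (ℤP.+-comm (+ p₀) (+ k)) (sym (ℤP.pos-+ k p₀))) ⟩
    + (k + p₀) ℤ.* + pstar₀                ≈⟨ *-cong (x≈x%N (+ (k + p₀))) (≈-refl {+ pstar₀}) ⟩
    + ((k + p₀) % q) ℤ.* + pstar₀          ≡⟨ ℤP.pos-* ((k + p₀) % q) pstar₀ ⟨
    + ((k + p₀) % q * pstar₀)              ∎)
    where open ≈-Reasoning

  zmod-jumpˡ : zmod (ℤ.- (p ℤ.+ + 1) ℤ.* pstar) q ≡ digitIndex (q ∸ suc p₀)
  zmod-jumpˡ = %ℕ-cong (begin
    ℤ.- (p ℤ.+ + 1) ℤ.* pstar       ≈⟨ *-cong (-‿cong (+-cong (x≈x%N p) (≈-refl {+ 1}))) (x≈x%N pstar) ⟩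
    ℤ.- (+ p₀ ℤ.+ + 1) ℤ.* + pstar₀ ≡⟨ cong (λ a → ℤ.- a ℤ.* + pstar₀) (trans (sym (ℤP.pos-+ p₀ 1)) (cong +_ (ℕP.+-comm p₀ 1))) ⟩
    ℤ.- (+ suc p₀) ℤ.* + pstar₀     ≈⟨ *-cong (∸≈- p₀<q) (≈-refl {+ pstar₀}) ⟨
    + (q ∸ suc p₀) ℤ.* + pstar₀     ≡⟨ ℤP.pos-* (q ∸ suc p₀) pstar₀ ⟨
    + ((q ∸ suc p₀) * pstar₀)       ∎)
    where open ≈-Reasoning

  zmod-jumpʳ : zmod (ℤ.- p ℤ.* pstar) q ≡ digitIndex (q ∸ p₀)
  zmod-jumpʳ = %ℕ-cong (begin
    ℤ.- p ℤ.* pstar         ≈⟨ *-cong (-‿cong (x≈x%N p)) (x≈x%N pstar) ⟩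
    ℤ.- (+ p₀) ℤ.* + pstar₀ ≈⟨ *-cong (∸≈- (ℕP.<⇒≤ p₀<q)) (≈-refl {+ pstar₀}) ⟨
    + (q ∸ p₀) ℤ.* + pstar₀ ≡⟨ ℤP.pos-* (q ∸ p₀) pstar₀ ⟨
    + ((q ∸ p₀) * pstar₀)   ∎)
    where open ≈-Reasoning

  p≡p₀+Pq : p ≡ + p₀ ℤ.+ p ℤD./ℕ q ℤ.* + q
  p≡p₀+Pq = ℤD.a≡a%ℕn+[a/ℕn]*n p q

  rotationNumber-r : ∀ {B} r → RotationalWith d B (r * q) (r * p₀) → RotationalWithNumber d B p q
  rotationNumber-r r rw = r * q , r * p₀ , rw , ℤ.- P , (begin
    + (r * p₀) ℤ.* + q
      ≡⟨ cong (ℤ._* + q) (ℤP.pos-* r p₀) ⟩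
    + r ℤ.* + p₀ ℤ.* + q
      ≡⟨ ring (+ r) (+ p₀) P (+ q) ⟩
    (+ p₀ ℤ.+ P ℤ.* + q) ℤ.* (+ r ℤ.* + q) ℤ.+ ℤ.- P ℤ.* (+ r ℤ.* + q) ℤ.* + q
      ≡⟨ cong₂ (λ a b → a ℤ.* b ℤ.+ ℤ.- P ℤ.* b ℤ.* + q) (sym p≡p₀+Pq) (sym (ℤP.pos-* r q)) ⟩
    p ℤ.* + (r * q) ℤ.+ ℤ.- P ℤ.* + (r * q) ℤ.* + q
      ∎)
    where
    open ≡-Reasoning
    P = p ℤD./ℕ q
    ring : ∀ r p₀ P q → r ℤ.* p₀ ℤ.* q ≡ (p₀ ℤ.+ P ℤ.* q) ℤ.* (r ℤ.* q) ℤ.+ ℤ.- P ℤ.* (r ℤ.* q) ℤ.* q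
    ring = ℤRing.solve-∀

  rotationNumber⇒q∣m : ∀ {m p' K} → + p' ℤ.* + q ≡ p ℤ.* + m ℤ.+ K ℤ.* + m ℤ.* + q → q ℕDiv.∣ m
  rotationNumber⇒q∣m {m} {p'} {K} eq = ℕDiv.m%n≡0⇒n∣m m q (%ℕ-cong m≈0)
    where
    pm≈0 : p ℤ.* + m ≈ 0ℤ
    pm≈0 = ≈-by-quotient (+ p' ℤ.- K ℤ.* + m) (begin
      p ℤ.* + m ℤ.- 0ℤ                                        ≡⟨ ring₁ (p ℤ.* + m) (K ℤ.* + m ℤ.* + q) ⟩
      (p ℤ.* + m ℤ.+ K ℤ.* + m ℤ.* + q) ℤ.- K ℤ.* + m ℤ.* + q ≡⟨ cong (ℤ._- K ℤ.* + m ℤ.* + q) eq ⟨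
      + p' ℤ.* + q ℤ.- K ℤ.* + m ℤ.* + q                      ≡⟨ ring₂ (+ p') K (+ m) (+ q) ⟩
      (+ p' ℤ.- K ℤ.* + m) ℤ.* + q                            ∎)
      where
      open ≡-Reasoning
      ring₁ : ∀ x y → x ℤ.- 0ℤ ≡ (x ℤ.+ y) ℤ.- y
      ring₁ = ℤRing.solve-∀
      ring₂ : ∀ p' K m q → p' ℤ.* q ℤ.- K ℤ.* m ℤ.* q ≡ (p' ℤ.- K ℤ.* m) ℤ.* q
      ring₂ = ℤRing.solve-∀
    m≈0 : + m ≈ 0ℤ
    m≈0 = begin
      + m                   ≡⟨ ℤP.*-identityˡ (+ m) ⟨
      + 1 ℤ.* + m           ≈⟨ *-cong ppstar≈1 (≈-refl {+ m}) ⟨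
      p ℤ.* pstar ℤ.* + m   ≡⟨ ring p pstar (+ m) ⟩
      pstar ℤ.* (p ℤ.* + m) ≈⟨ *-cong (≈-refl {pstar}) pm≈0 ⟩
      pstar ℤ.* 0ℤ          ≡⟨ ℤP.*-zeroʳ pstar ⟩
      0ℤ                    ∎
      where
      open ≈-Reasoning
      ring : ∀ p s m → p ℤ.* s ℤ.* m ≡ s ℤ.* (p ℤ.* m)
      ring = ℤRing.solve-∀

  rotationNumber⇒p'≡rp₀ : ∀ {r p' K} → p' ℕ.< r * q →
    + p' ℤ.* + q ≡ p ℤ.* + (r * q) ℤ.+ K ℤ.* + (r * q) ℤ.* + q → p' ≡ r * p₀
  rotationNumber⇒p'≡rp₀ {zero}         ()
  rotationNumber⇒p'≡rp₀ {r@(suc _)} {p'} {K} p'<rq eq =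
    M.residue-unique p'<rq (ℕP.*-monoʳ-< r p₀<q) (M.≈-by-quotient (P ℤ.+ K) (begin
      + p' ℤ.- + (r * p₀)
        ≡⟨ cong₂ ℤ._-_ p'≡ (ℤP.pos-* r p₀) ⟩
      p ℤ.* + r ℤ.+ K ℤ.* + (r * q) ℤ.- + r ℤ.* + p₀
        ≡⟨ cong₂ (λ a b → a ℤ.* + r ℤ.+ K ℤ.* b ℤ.- + r ℤ.* + p₀) p≡p₀+Pq (ℤP.pos-* r q) ⟩
      (+ p₀ ℤ.+ P ℤ.* + q) ℤ.* + r ℤ.+ K ℤ.* (+ r ℤ.* + q) ℤ.- + r ℤ.* + p₀
        ≡⟨ ring₁ (+ p₀) P (+ q) (+ r) K ⟩
      (P ℤ.+ K) ℤ.* (+ r ℤ.* + q)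
        ≡⟨ cong ((P ℤ.+ K) ℤ.*_) (ℤP.pos-* r q) ⟨
      (P ℤ.+ K) ℤ.* + (r * q)
        ∎))
    where
    module M = Congruence (r * q)
    open ≡-Reasoning
    P = p ℤD./ℕ q
    ring₁ : ∀ p₀ P q r K → (p₀ ℤ.+ P ℤ.* q) ℤ.* r ℤ.+ K ℤ.* (r ℤ.* q) ℤ.- r ℤ.* p₀ ≡ (P ℤ.+ K) ℤ.* (r ℤ.* q)
    ring₁ = ℤRing.solve-∀
    ring₂ : ∀ p r q x → p ℤ.* (r ℤ.* q) ℤ.+ x ℤ.* q ≡ (p ℤ.* r ℤ.+ x) ℤ.* q
    ring₂ = ℤRing.solve-∀
    p'≡ : + p' ≡ p ℤ.* + r ℤ.+ K ℤ.* + (r * q)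
    p'≡ = ℤP.*-cancelʳ-≡ _ _ (+ q) (begin
      + p' ℤ.* + q                                    ≡⟨ eq ⟩
      p ℤ.* + (r * q) ℤ.+ K ℤ.* + (r * q) ℤ.* + q     ≡⟨ cong (λ x → p ℤ.* x ℤ.+ K ℤ.* + (r * q) ℤ.* + q) (ℤP.pos-* r q) ⟩
      p ℤ.* (+ r ℤ.* + q) ℤ.+ K ℤ.* + (r * q) ℤ.* + q ≡⟨ ring₂ p (+ r) (+ q) (K ℤ.* + (r * q)) ⟩
      (p ℤ.* + r ℤ.+ K ℤ.* + (r * q)) ℤ.* + q         ∎)

  rotationNumber⇒r : ∀ {B} → RotationalWithNumber d B p q → ∃ λ r → RotationalWith d B (r * q) (r * p₀)
  rotationNumber⇒r {B} (m , p' , rw , K , eq) = r , subst₂ (RotationalWith d B) m≡rq p'≡rp₀ rw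
    where
    r = ℕDiv._∣_.quotient (rotationNumber⇒q∣m {m} {p'} {K} eq)
    m≡rq : m ≡ r * q
    m≡rq = ℕDiv._∣_.equality (rotationNumber⇒q∣m {m} {p'} {K} eq)
    p'≡rp₀ : p' ≡ r * p₀
    p'≡rp₀ = rotationNumber⇒p'≡rp₀ {r} {p'} {K} (subst (p' ℕ.<_) m≡rq (proj₁ (proj₂ rw)))
      (subst (λ x → + p' ℤ.* + q ≡ p ℤ.* + x ℤ.+ K ℤ.* + x ℤ.* + q) m≡rq eq)

  A : ℚ → Set
  A s = ∃ λ i → (1 ℕ.≤ i) × (i ℕ.≤ n) × InOrbit d (t i) s

  -- entry (k * n + c) is the term a^{(c+1)}_{k p*} of the sequence in (ii): orbits are indexed from 0.
  block-digit : ℕ → ℕ → ℤ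
  block-digit k c = digit d (t (suc c)) (digitIndex k)

  entry : ℕ → ℤ
  entry i = block-digit (i / n) (i % n)

  digitSeq≡ : digitSeq d q n t pstar ≡ applyUpTo entry (q * n)
  digitSeq≡ = begin
    concat (map row (upTo q))                                ≡⟨ cong concat (map-upTo row q) ⟩
    concat (applyUpTo row q)                                 ≡⟨ cong concat (applyUpTo-cong q λ {k} _ → row≡ k) ⟩
    concat (applyUpTo (λ k → applyUpTo (block-digit k) n) q) ≡⟨ concat-applyUpTo n block-digit q ⟩
    applyUpTo entry (q * n)                                  ∎
    where
    open ≡-Reasoning
    row : ℕ → List ℤ
    row k = map (λ j → a d q (t j) (+ k ℤ.* pstar)) (map suc (upTo n))
    row≡ : ∀ k → row k ≡ applyUpTo (block-digit k) n
    row≡ k = trans (cong (map _) (map-upTo suc n)) (trans (map-applyUpTo suc _ n)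
               (applyUpTo-cong n λ {c} _ → cong (digit d (t (suc c))) (zmod≡digitIndex k)))

  jump≡ : (a d q (t n) (ℤ.- (p ℤ.+ + 1) ℤ.* pstar) ℤ.< a d q (t 1) (ℤ.- p ℤ.* pstar)) ≡
          (block-digit (q ∸ suc p₀) n-1 ℤ.< block-digit (q ∸ p₀) 0)
  jump≡ = cong₂ (λ e e' → digit d (t n) e ℤ.< digit d (t 1) e') zmod-jumpˡ zmod-jumpʳ

  module DigitsToRotation
    (periodic : ∀ i → 1 ℕ.≤ i → i ℕ.≤ n → iter d q (t i) ≡ t i)
    (card : ∀ i → 1 ℕ.≤ i → i ℕ.≤ n → HasCard (InOrbit d (t i)) q)
    (distinct : ∀ i j → 1 ℕ.≤ i → i ℕ.< j → j ℕ.≤ n → ¬ SameSet (InOrbit d (t i)) (InOrbit d (t j)))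
    (sorted : Linked ℤ._≤_ (digitSeq d q n t pstar))
    (jump : a d q (t n) (ℤ.- (p ℤ.+ + 1) ℤ.* pstar) ℤ.< a d q (t 1) (ℤ.- p ℤ.* pstar))
    where

    open Rotation (q * n) (p₀ * n)

    S : ℕ → ℚ
    S i = iter d (digitIndex (i / n)) (t (suc (i % n)))

    S-block : ∀ k {c} → c ℕ.< n → S (k * n + c) ≡ iter d (digitIndex k) (t (suc c))
    S-block k c<n = cong₂ (λ k' c' → iter d (digitIndex k') (t (suc c'))) (block-/ n k c<n) (block-% n k c<n)

    periodic′ : ∀ {c} → c ℕ.< n → iter d q (t (suc c)) ≡ t (suc c)
    periodic′ c<n = periodic _ (s≤s z≤n) c<n

    σ-S-block : ∀ k {c} → c ℕ.< n → σ d (S (k * n + c)) ≡ S ((k + p₀) % q * n + c)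
    σ-S-block k {c} c<n = begin
      σ d (S (k * n + c))                            ≡⟨ cong (σ d) (S-block k c<n) ⟩
      iter d (suc (digitIndex k)) (t (suc c))        ≡⟨ iter-%-period d q (periodic′ c<n) (suc (digitIndex k)) ⟩
      iter d (suc (digitIndex k) % q) (t (suc c))    ≡⟨ cong (λ e → iter d e (t (suc c))) (digitIndex-suc k) ⟩
      iter d (digitIndex ((k + p₀) % q)) (t (suc c)) ≡⟨ S-block ((k + p₀) % q) c<n ⟨
      S ((k + p₀) % q * n + c)                       ∎
      where open ≡-Reasoning

    σ-S : ∀ i → σ d (S i) ≡ S (rot i)
    σ-S i = begin
      σ d (S i)                                  ≡⟨ cong (σ d ∘ S) (block-split n i) ⟩
      σ d (S (i / n * n + i % n))                ≡⟨ σ-S-block (i / n) (ℕD.m%n<n i n) ⟩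
      S ((i / n + p₀) % q * n + i % n)           ≡⟨ cong S (block-shift n (i / n) p₀ (ℕD.m%n<n i n)) ⟨
      S ((i / n * n + i % n + p₀ * n) % (q * n)) ≡⟨ cong (λ j → S ((j + p₀ * n) % (q * n))) (block-split n i) ⟨
      S (rot i)                                  ∎
      where open ≡-Reasoning

    block-injective : ∀ {k k' c c'} → k ℕ.< q → k' ℕ.< q → c ℕ.< n → c' ℕ.< n →
                      iter d (digitIndex k) (t (suc c)) ≡ iter d (digitIndex k') (t (suc c')) → k ≡ k' × c ≡ c'
    block-injective {k} {k'} {c} {c'} k<q k'<q c<n c'<n eq with ℕP.<-cmp c c'
    ... | tri< c<c' _ _ =
      contradiction (sameOrbit d q-1 (digitIndex k) (digitIndex k') (periodic′ c<n) (periodic′ c'<n) eq)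
                    (distinct (suc c) (suc c') (s≤s z≤n) (s≤s c<c') c'<n)
    ... | tri> _ _ c'<c =
      contradiction (sameOrbit d q-1 (digitIndex k') (digitIndex k) (periodic′ c'<n) (periodic′ c<n) (sym eq))
                    (distinct (suc c') (suc c) (s≤s z≤n) (s≤s c'<c) c<n)
    ... | tri≈ _ refl _ = k≡k' , refl
      where
      same-index : digitIndex k ≡ digitIndex k'
      same-index = iter-injective d q (digitIndex k) (digitIndex k') (card (suc c) (s≤s z≤n) c<n) (periodic′ c<n)
                     (ℕD.m%n<n (k * pstar₀) q) (ℕD.m%n<n (k' * pstar₀) q) eq
      k≡k' : k ≡ k'
      k≡k' = trans (sym (p₀-cancel-digitIndex k<q))
               (trans (cong (λ e → (e * p₀) % q) same-index) (p₀-cancel-digitIndex k'<q))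

    S-injective : ∀ {i j} → i ℕ.< q * n → j ℕ.< q * n → S i ≡ S j → i ≡ j
    S-injective {i} {j} i<qn j<qn eq
      with k≡ , c≡ ← block-injective {i / n} {j / n} {i % n} {j % n}
                       (ℕD.m<n*o⇒m/o<n {i} {q} {n} i<qn) (ℕD.m<n*o⇒m/o<n {j} {q} {n} j<qn)
                       (ℕD.m%n<n i n) (ℕD.m%n<n j n) eq =
      trans (block-split n i) (trans (cong₂ (λ k c → k * n + c) k≡ c≡) (sym (block-split n j)))

    J : ℕ
    J = (q ∸ suc p₀) * n + n-1

    1+J≡ : suc J ≡ (q ∸ p₀) * n + 0
    1+J≡ = begin
      suc ((q ∸ suc p₀) * n + n-1) ≡⟨ ℕP.+-suc ((q ∸ suc p₀) * n) n-1 ⟨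
      (q ∸ suc p₀) * n + n         ≡⟨ ℕP.+-comm ((q ∸ suc p₀) * n) n ⟩
      suc (q ∸ suc p₀) * n         ≡⟨ cong (_* n) q∸p₀≡1+q∸[1+p₀] ⟨
      (q ∸ p₀) * n                 ≡⟨ ℕP.+-identityʳ _ ⟨
      (q ∸ p₀) * n + 0             ∎
      where open ≡-Reasoning

    cut : suc J + p₀ * n ≡ q * n
    cut = begin
      suc J + p₀ * n        ≡⟨ cong (_+ p₀ * n) (trans 1+J≡ (ℕP.+-identityʳ _)) ⟩
      (q ∸ p₀) * n + p₀ * n ≡⟨ ℕP.*-distribʳ-+ n (q ∸ p₀) p₀ ⟨
      (q ∸ p₀ + p₀) * n     ≡⟨ cong (_* n) (ℕP.m∸n+n≡m (ℕP.<⇒≤ p₀<q)) ⟩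
      q * n                 ∎
      where open ≡-Reasoning

    digits-sorted : ∀ {i j} → i ℕ.≤ j → j ℕ.< q * n → digit d (S i) 0 ℤ.≤ digit d (S j) 0
    digits-sorted = Linked-applyUpTo⁻ ℤP.≤-refl ℤP.≤-trans entry (q * n) (subst (Linked ℤ._≤_) digitSeq≡ sorted)

    digit-jump : digit d (S J) 0 ℤ.< digit d (S (suc J)) 0
    digit-jump = subst₂ ℤ._<_ (cong (λ x → digit d x 0) (sym (S-block (q ∸ suc p₀) (ℕP.n<1+n n-1))))
                             (cong (λ x → digit d x 0) (trans (sym (S-block (q ∸ p₀) (s≤s z≤n))) (cong S (sym 1+J≡))))
                             (subst id jump≡ jump)

    open SortedByDigits d 2≤d (q * n) (p₀ * n) J cut S (λ {i} _ → σ-S i) digits-sorted digit-jump using (increasing)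

    S-increasing : ∀ {i j} → i ℕ.< j → j ℕ.< q * n → S i ℚ.< S j
    S-increasing = increasing S-injective

    S-monotone : ∀ {i j} → i ℕ.≤ j → j ℕ.< q * n → S i ℚ.≤ S j
    S-monotone i≤j j<qn with ℕP.m≤n⇒m<n∨m≡n i≤j
    ... | inj₁ i<j  = ℚP.<⇒≤ (S-increasing i<j j<qn)
    ... | inj₂ refl = ℚP.≤-refl

    orbit-S : ∀ {c} → c ℕ.< n → ∀ e → iter d e (t (suc c)) ≡ S ((e * p₀) % q * n + c)
    orbit-S {c} c<n e = begin
      iter d e (t (suc c))                           ≡⟨ iter-%-period d q (periodic′ c<n) e ⟩
      iter d (e % q) (t (suc c))                     ≡⟨ cong (λ x → iter d x (t (suc c))) (digitIndex-cancel-p₀ e) ⟨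
      iter d (digitIndex ((e * p₀) % q)) (t (suc c)) ≡⟨ S-block ((e * p₀) % q) c<n ⟨
      S ((e * p₀) % q * n + c)                       ∎
      where open ≡-Reasoning

    least : ∀ i → 1 ℕ.≤ i → i ℕ.≤ n → ∀ s → InOrbit d (t i) s → t i ℚ.≤ s
    least (suc c) _ c<n s (e , refl) = subst₂ ℚ._≤_ (S-block 0 c<n) (sym (orbit-S c<n e))
      (S-monotone (ℕP.m≤n+m c ((e * p₀) % q * n)) (block-< (ℕD.m%n<n (e * p₀) q) c<n))

    A≡image : ∀ x → (A x → ∃ λ i → (i ℕ.< q * n) × (S i ≡ x)) × ((∃ λ i → (i ℕ.< q * n) × (S i ≡ x)) → A x)
    A≡image x =
      (λ { (suc c , _ , c<n , e , refl) → (e * p₀) % q * n + c , block-< (ℕD.m%n<n (e * p₀) q) c<n , sym (orbit-S c<n e) }) ,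
      (λ { (i , _ , refl) → suc (i % n) , s≤s z≤n , ℕD.m%n<n i n , digitIndex (i / n) , refl })

    rotational : RotationalWith d A (n * q) (n * p₀)
    rotational = subst₂ (RotationalWith d A) (ℕP.*-comm q n) (ℕP.*-comm p₀ n)
      ( ℕP.<-≤-trans 0<p₀ (ℕP.m≤m*n p₀ n) , ℕP.*-monoˡ-< n p₀<q
      , S , (λ i j → S-increasing) , A≡image , (λ i _ → σ-S i))

  module RotationToDigits
    (t-increasing : ∀ i j → 1 ℕ.≤ i → i ℕ.< j → j ℕ.≤ n → t i ℚ.< t j)
    (least : ∀ i → 1 ℕ.≤ i → i ℕ.≤ n → ∀ s → InOrbit d (t i) s → t i ℚ.≤ s)
    (r-1 : ℕ) (rotational : RotationalWith d A (suc r-1 * q) (suc r-1 * p₀))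
    where

    r M : ℕ
    r = suc r-1
    M = r * q

    open Rotation M (r * p₀)

    s : ℕ → ℚ
    s = proj₁ (proj₂ (proj₂ rotational))

    s-increasing : ∀ {i j} → i ℕ.< j → j ℕ.< M → s i ℚ.< s j
    s-increasing = proj₁ (proj₂ (proj₂ (proj₂ rotational))) _ _

    s-image : ∀ x → A x → ∃ λ i → (i ℕ.< M) × (s i ≡ x)
    s-image x = proj₁ (proj₁ (proj₂ (proj₂ (proj₂ (proj₂ rotational)))) x)

    σ-s : ∀ {i} → i ℕ.< M → σ d (s i) ≡ s (rot i)
    σ-s = proj₂ (proj₂ (proj₂ (proj₂ (proj₂ rotational)))) _

    s-monotone : ∀ {i j} → i ℕ.≤ j → j ℕ.< M → s i ℚ.≤ s j
    s-monotone i≤j j<M with ℕP.m≤n⇒m<n∨m≡n i≤j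
    ... | inj₁ i<j  = ℚP.<⇒≤ (s-increasing i<j j<M)
    ... | inj₂ refl = ℚP.≤-refl

    rank : ∀ {c} → c ℕ.< n → ℕ
    rank c<n = proj₁ (s-image _ (_ , s≤s z≤n , c<n , 0 , refl))

    rank<M : ∀ {c} (c<n : c ℕ.< n) → rank c<n ℕ.< M
    rank<M c<n = proj₁ (proj₂ (s-image _ (_ , s≤s z≤n , c<n , 0 , refl)))

    s-rank : ∀ {c} (c<n : c ℕ.< n) → s (rank c<n) ≡ t (suc c)
    s-rank c<n = proj₂ (proj₂ (s-image _ (_ , s≤s z≤n , c<n , 0 , refl)))

    iter-s : ∀ e {i} → i ℕ.< M → iter d e (s i) ≡ s ((i + (e * p₀) % q * r) % M)
    iter-s e {i} i<M = begin
      iter d e (s i)              ≡⟨ iter-rotation d s σ-s e i<M ⟩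
      s (rot^ e i)                ≡⟨ cong s (rot^-closed e i<M) ⟩
      s ((i + e * (r * p₀)) % M)  ≡⟨ cong (λ x → s (x % M)) expand ⟩
      s ((i + K * r + W * M) % M) ≡⟨ cong s (ℕD.[m+kn]%n≡m%n (i + K * r) W M) ⟩
      s ((i + K * r) % M)         ∎
      where
      open ≡-Reasoning
      K = (e * p₀) % q
      W = (e * p₀) / q
      expand : i + e * (r * p₀) ≡ i + K * r + W * M
      expand = begin
        i + e * (r * p₀)    ≡⟨ ring₁ i e r p₀ ⟩
        i + e * p₀ * r      ≡⟨ cong (λ x → i + x * r) (ℕD.m≡m%n+[m/n]*n (e * p₀) q) ⟩
        i + (K + W * q) * r ≡⟨ ring₂ i K W q r ⟩
        i + K * r + W * M   ∎
        where
        ring₁ : ∀ i e r p → i + e * (r * p) ≡ i + e * p * r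
        ring₁ = ℕRing.solve-∀
        ring₂ : ∀ i K W q r → i + (K + W * q) * r ≡ i + K * r + W * (r * q)
        ring₂ = ℕRing.solve-∀

    -- Otherwise σ^{(q-1) p*₀}, which lowers ranks by r, would give a smaller point of the orbit.
    rank<r : ∀ {c} (c<n : c ℕ.< n) → rank c<n ℕ.< r
    rank<r {c} c<n with rank c<n ℕ.<? r
    ... | yes rank<r = rank<r
    ... | no  rank≮r = contradiction (ℚP.≤-<-trans (least (suc c) (s≤s z≤n) c<n _ (digitIndex q-1 , refl))
                         (subst₂ ℚ._<_ (sym iterate-back) (s-rank c<n) (s-increasing back<rank (rank<M c<n))))
                         (ℚP.<-irrefl refl)
      where
      open ≡-Reasoning
      x = rank c<n
      r≤x = ℕP.≮⇒≥ rank≮r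
      back<rank : x ∸ r ℕ.< x
      back<rank = ℕP.∸-monoʳ-< {x} {r} {0} (s≤s z≤n) r≤x
      wrap : x + q-1 * r ≡ x ∸ r + M
      wrap = begin
        x + q-1 * r         ≡⟨ cong (_+ q-1 * r) (ℕP.m∸n+n≡m r≤x) ⟨
        x ∸ r + r + q-1 * r ≡⟨ ℕP.+-assoc (x ∸ r) r (q-1 * r) ⟩
        x ∸ r + q * r       ≡⟨ cong (λ y → x ∸ r + y) (ℕP.*-comm q r) ⟩
        x ∸ r + M           ∎
      iterate-back : iter d (digitIndex q-1) (t (suc c)) ≡ s (x ∸ r)
      iterate-back = begin
        iter d (digitIndex q-1) (t (suc c))         ≡⟨ cong (iter d (digitIndex q-1)) (s-rank c<n) ⟨
        iter d (digitIndex q-1) (s x)               ≡⟨ iter-s (digitIndex q-1) (rank<M c<n) ⟩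
        s ((x + (digitIndex q-1 * p₀) % q * r) % M) ≡⟨ cong (λ k → s ((x + k * r) % M)) (p₀-cancel-digitIndex (ℕP.n<1+n q-1)) ⟩
        s ((x + q-1 * r) % M)                       ≡⟨ cong (λ y → s (y % M)) wrap ⟩
        s ((x ∸ r + M) % M)                         ≡⟨ cong s (ℕD.[m+n]%n≡m%n (x ∸ r) M) ⟩
        s ((x ∸ r) % M)                             ≡⟨ cong s (ℕD.m<n⇒m%n≡m (ℕP.≤-<-trans (ℕP.m∸n≤m x r) (rank<M c<n))) ⟩
        s (x ∸ r)                                   ∎

    offset<M : ∀ {x k} → x ℕ.< r → k ℕ.< q → x + k * r ℕ.< M
    offset<M {x} {k} x<r k<q = begin-strict
      x + k * r <⟨ ℕP.+-monoˡ-< (k * r) x<r ⟩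
      suc k * r ≤⟨ ℕP.*-monoˡ-≤ r k<q ⟩
      q * r     ≡⟨ ℕP.*-comm q r ⟩
      M         ∎
      where open ℕP.≤-Reasoning

    block-digit≡ : ∀ k {c} (c<n : c ℕ.< n) → k ℕ.< q → block-digit k c ≡ digit d (s (rank c<n + k * r)) 0
    block-digit≡ k {c} c<n k<q = cong (λ x → digit d x 0) (begin
      iter d (digitIndex k) (t (suc c))         ≡⟨ cong (iter d (digitIndex k)) (s-rank c<n) ⟨
      iter d (digitIndex k) (s x)               ≡⟨ iter-s (digitIndex k) (rank<M c<n) ⟩
      s ((x + (digitIndex k * p₀) % q * r) % M) ≡⟨ cong (λ j → s ((x + j * r) % M)) (p₀-cancel-digitIndex k<q) ⟩
      s ((x + k * r) % M)                       ≡⟨ cong s (ℕD.m<n⇒m%n≡m (offset<M (rank<r c<n) k<q)) ⟩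
      s (x + k * r)                             ∎)
      where
      open ≡-Reasoning
      x = rank c<n

    rank-monotone : ∀ {c c'} (c<n : c ℕ.< n) (c'<n : c' ℕ.< n) → c ℕ.≤ c' → rank c<n ℕ.≤ rank c'<n
    rank-monotone {c} {c'} c<n c'<n c≤c' = ℕP.≮⇒≥ λ rank'<rank → ℚP.<-irrefl refl (ℚP.<-≤-trans
      (subst₂ ℚ._<_ (s-rank c'<n) (s-rank c<n) (s-increasing rank'<rank (rank<M c<n)))
      (t-monotone c≤c'))
      where
      t-monotone : c ℕ.≤ c' → t (suc c) ℚ.≤ t (suc c')
      t-monotone c≤c' with ℕP.m≤n⇒m<n∨m≡n c≤c'
      ... | inj₁ c<c' = ℚP.<⇒≤ (t-increasing (suc c) (suc c') (s≤s z≤n) (s≤s c<c') c'<n)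
      ... | inj₂ refl = ℚP.≤-refl

    entry-block : ∀ k {c} (c<n : c ℕ.< n) → k ℕ.< q → entry (k * n + c) ≡ digit d (s (rank c<n + k * r)) 0
    entry-block k c<n k<q = trans (cong₂ block-digit (block-/ n k c<n) (block-% n k c<n)) (block-digit≡ k c<n k<q)

    step-within-block : ∀ k {c} (c<n : c ℕ.< n) (1+c<n : suc c ℕ.< n) → k ℕ.< q →
                        entry (k * n + c) ℤ.≤ entry (k * n + suc c)
    step-within-block k {c} c<n 1+c<n k<q = subst₂ ℤ._≤_ (sym (entry-block k c<n k<q)) (sym (entry-block k 1+c<n k<q))
      (digit-mono-≤ d (s-monotone (ℕP.+-monoˡ-≤ (k * r) (rank-monotone c<n 1+c<n (ℕP.n≤1+n c)))
                                  (offset<M (rank<r 1+c<n) k<q)))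

    offset<next-offset : ∀ {x} y k → x ℕ.< r → x + k * r ℕ.< y + suc k * r
    offset<next-offset {x} y k x<r = begin-strict
      x + k * r     <⟨ ℕP.+-monoˡ-< (k * r) x<r ⟩
      suc k * r     ≤⟨ ℕP.m≤n+m (suc k * r) y ⟩
      y + suc k * r ∎
      where open ℕP.≤-Reasoning

    step-across-blocks : ∀ k {c} (c<n : c ℕ.< n) → suc k ℕ.< q → entry (k * n + c) ℤ.≤ entry (suc k * n + 0)
    step-across-blocks k c<n 1+k<q =
      subst₂ ℤ._≤_ (sym (entry-block k c<n (ℕP.<-trans (ℕP.n<1+n k) 1+k<q))) (sym (entry-block (suc k) first 1+k<q))
        (digit-mono-≤ d (s-monotone (ℕP.<⇒≤ (offset<next-offset (rank first) k (rank<r c<n)))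
                                    (offset<M (rank<r first) 1+k<q)))
      where first = s≤s z≤n

    entry-sorted : ∀ {i} → suc i ℕ.< q * n → entry i ℤ.≤ entry (suc i)
    entry-sorted {i} 1+i<qn with suc (i % n) ℕ.<? n
    ... | yes 1+c<n = subst₂ (λ a b → entry a ℤ.≤ entry b) (sym i≡) (trans (ℕP.+-suc (k * n) c) (cong suc (sym i≡)))
                        (step-within-block k c<n 1+c<n k<q)
      where
      k = i / n
      c = i % n
      c<n = ℕD.m%n<n i n
      i≡ = block-split n i
      k<q = ℕD.m<n*o⇒m/o<n {i} {q} {n} (ℕP.<-trans (ℕP.n<1+n i) 1+i<qn)
    ... | no  1+c≮n = subst₂ (λ a b → entry a ℤ.≤ entry b) (sym i≡) (sym 1+i≡)
                        (step-across-blocks k c<n 1+k<q)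
      where
      k = i / n
      c = i % n
      c<n = ℕD.m%n<n i n
      i≡ = block-split n i
      1+i≡ : suc i ≡ suc k * n + 0
      1+i≡ = begin
        suc i           ≡⟨ cong suc i≡ ⟩
        suc (k * n + c) ≡⟨ ℕP.+-suc (k * n) c ⟨
        k * n + suc c   ≡⟨ cong (λ x → k * n + x) (ℕP.≤-antisym c<n (ℕP.≮⇒≥ 1+c≮n)) ⟩
        k * n + n       ≡⟨ ℕP.+-comm (k * n) n ⟩
        suc k * n       ≡⟨ ℕP.+-identityʳ (suc k * n) ⟨
        suc k * n + 0   ∎
        where open ≡-Reasoning
      1+k<q : suc k ℕ.< q
      1+k<q = subst (ℕ._< q) (block-/ n (suc k) (s≤s z≤n))
                (ℕD.m<n*o⇒m/o<n {suc k * n + 0} {q} {n} (subst (ℕ._< q * n) 1+i≡ 1+i<qn))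

    σ-offset : ∀ {x} k → x ℕ.< r → k ℕ.< q → σ d (s (x + k * r)) ≡ s ((x + (k + p₀) * r) % M)
    σ-offset {x} k x<r k<q = trans (σ-s (offset<M x<r k<q)) (cong (λ y → s (y % M)) (ring x k r p₀))
      where
      ring : ∀ x k r p → x + k * r + r * p ≡ x + (k + p) * r
      ring = ℕRing.solve-∀

    σ-offset-within : ∀ {x} k → x ℕ.< r → k + p₀ ℕ.< q → σ d (s (x + k * r)) ≡ s (x + (k + p₀) * r)
    σ-offset-within k x<r k+p₀<q =
      trans (σ-offset k x<r (ℕP.≤-<-trans (ℕP.m≤m+n k p₀) k+p₀<q)) (cong s (ℕD.m<n⇒m%n≡m (offset<M x<r k+p₀<q)))

    σ-offset-wraps : ∀ {x} k → x ℕ.< r → k ℕ.< q → k + p₀ ≡ q → σ d (s (x + k * r)) ≡ s x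
    σ-offset-wraps {x} k x<r k<q k+p₀≡q = begin
      σ d (s (x + k * r))        ≡⟨ σ-offset k x<r k<q ⟩
      s ((x + (k + p₀) * r) % M) ≡⟨ cong (λ j → s ((x + j) % M)) (trans (cong (_* r) k+p₀≡q) (ℕP.*-comm q r)) ⟩
      s ((x + M) % M)            ≡⟨ cong s (ℕD.[m+n]%n≡m%n x M) ⟩
      s (x % M)                  ≡⟨ cong s (ℕD.m<n⇒m%n≡m (ℕP.<-≤-trans x<r (ℕP.m≤m*n r q))) ⟩
      s x                        ∎
      where open ≡-Reasoning

    -- σ reverses the order of the two points: the second one wraps around to rank first.
    jump-block : block-digit (q ∸ suc p₀) n-1 ℤ.< block-digit (q ∸ p₀) 0
    jump-block = subst₂ ℤ._<_ (sym (block-digit≡ u-1 last u-1<q)) (sym (block-digit≡ u first u<q))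
      (σ-antitone⇒digit-< (ℕP.<-trans (s≤s z≤n) 2≤d) sX<sY (subst₂ ℚ._≤_ (sym σY≡) (sym σX≡) σY≤σX))
      where
      last = ℕP.n<1+n n-1
      first = s≤s z≤n
      u = q ∸ p₀
      u-1 = q ∸ suc p₀
      u<q : u ℕ.< q
      u<q = ℕP.∸-monoʳ-< {q} {p₀} {0} 0<p₀ (ℕP.<⇒≤ p₀<q)
      u-1<q : u-1 ℕ.< q
      u-1<q = s≤s (ℕP.m∸n≤m q-1 p₀)
      u-1+p₀<q : u-1 + p₀ ℕ.< q
      u-1+p₀<q = subst (ℕ._< q) (sym (ℕP.m∸n+n≡m (ℕP.≤-pred p₀<q))) (ℕP.n<1+n q-1)
      sX<sY : s (rank last + u-1 * r) ℚ.< s (rank first + u * r)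
      sX<sY = s-increasing (subst (λ k → rank last + u-1 * r ℕ.< rank first + k * r) (sym q∸p₀≡1+q∸[1+p₀])
                             (offset<next-offset (rank first) u-1 (rank<r last)))
                           (offset<M (rank<r first) u<q)
      σX≡ : σ d (s (rank last + u-1 * r)) ≡ s (rank last + (u-1 + p₀) * r)
      σX≡ = σ-offset-within u-1 (rank<r last) u-1+p₀<q
      σY≡ : σ d (s (rank first + u * r)) ≡ s (rank first)
      σY≡ = σ-offset-wraps u (rank<r first) u<q (ℕP.m∸n+n≡m (ℕP.<⇒≤ p₀<q))
      σY≤σX : s (rank first) ℚ.≤ s (rank last + (u-1 + p₀) * r)
      σY≤σX = s-monotone (ℕP.≤-trans (rank-monotone first last z≤n) (ℕP.m≤m+n (rank last) ((u-1 + p₀) * r)))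
                         (offset<M (rank<r last) u-1+p₀<q)

    digits : Linked ℤ._≤_ (digitSeq d q n t pstar) ×
             (a d q (t n) (ℤ.- (p ℤ.+ + 1) ℤ.* pstar) ℤ.< a d q (t 1) (ℤ.- p ℤ.* pstar))
    digits = subst (Linked ℤ._≤_) (sym digitSeq≡) (LinkedP.applyUpTo⁺₁ entry (q * n) entry-sorted)
           , subst id (sym jump≡) jump-block

  rotational⇒digits :
    (∀ i j → 1 ℕ.≤ i → i ℕ.< j → j ℕ.≤ n → t i ℚ.< t j) →
    (∀ i → 1 ℕ.≤ i → i ℕ.≤ n → ∀ s → InOrbit d (t i) s → t i ℚ.≤ s) →
    (∃ λ r → RotationalWith d A (r * q) (r * p₀)) →
    Linked ℤ._≤_ (digitSeq d q n t pstar) × (a d q (t n) (ℤ.- (p ℤ.+ + 1) ℤ.* pstar) ℤ.< a d q (t 1) (ℤ.- p ℤ.* pstar))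
  rotational⇒digits t-increasing least (zero    , () , _)
  rotational⇒digits t-increasing least (suc r-1 , rotational) = RotationToDigits.digits t-increasing least r-1 rotational

theorem3p1 : (d : ℕ) → 2 ℕ.≤ d →
  (p : ℤ) (q : ℕ) → 2 ℕ.≤ q → ¬ ((+ q) ∣ p) → gcd p (+ q) ≡ + 1 →
  (pstar : ℤ) → (+ q) ∣ (p ℤ.* pstar ℤ.- + 1) →
  (n : ℕ) → 1 ℕ.≤ n →
  (t : ℕ → ℚ) →
  (∀ i → 1 ℕ.≤ i → i ℕ.≤ n → In𝕋 (t i)) →
  (∀ i → 1 ℕ.≤ i → i ℕ.≤ n → iter d q (t i) ≡ t i) →
  (∀ i → 1 ℕ.≤ i → i ℕ.≤ n → HasCard (InOrbit d (t i)) q) →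
  (∀ i j → 1 ℕ.≤ i → i ℕ.< j → j ℕ.≤ n →
    ¬ SameSet (InOrbit d (t i)) (InOrbit d (t j))) →
  (∀ i j → 1 ℕ.≤ i → i ℕ.< j → j ℕ.≤ n → t i ℚ.< t j) →
  ((∀ i → 1 ℕ.≤ i → i ℕ.≤ n → ∀ s → InOrbit d (t i) s → t i ℚ.≤ s) ×
     RotationalWithNumber d (λ s → ∃ λ i → (1 ℕ.≤ i) × (i ℕ.≤ n) × InOrbit d (t i) s) p q)
  ⇔
  (Linked ℤ._≤_ (digitSeq d q n t pstar) ×
     (a d q (t n) (ℤ.- (p ℤ.+ + 1) ℤ.* pstar) ℤ.< a d q (t 1) (ℤ.- p ℤ.* pstar)))

theorem3p1 _ _ _ zero () _ _ _ _ _ _ _ _ _ _ _ _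
theorem3p1 _ _ _ (suc _) _ _ _ _ _ zero () _ _ _ _ _ _
theorem3p1 d 2≤d p (suc q-1) _ q∤p _ pstar inverse (suc n-1) _ t _ periodic card distinct t-increasing = mk⇔
  (λ (least , rotational) → rotational⇒digits t-increasing least (rotationNumber⇒r rotational))
  (λ (sorted , jump) → let open DigitsToRotation periodic card distinct sorted jump in
                       least , rotationNumber-r n rotational)
  where open Setting d 2≤d p q-1 q∤p pstar inverse n-1 t
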